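{- Let $X,Y$ be orthomodular lattices and let $f\colon X\to Y$ be a linear map with adjoint $f^*$. Then $\ker f=\{x\in X: f(x)=0\}$ equals ${\downarrow} f^*(1)^\perp=\{x\in X: x\le f^*(1)^\perp\}$, and hence is an orthomodular lattice (with the order, meets and joins of $X$ and orthocomplement $u\mapsto f^*(1)^\perp\wedge u^\perp$).
   Context: Orthomodular lattice: a bounded lattice $X$ with a map $x\mapsto x^\perp$ such that $x^{\perp\perp}=x$, $x\le y\Rightarrow y^\perp\le x^\perp$, $x\wedge x^\perp=0$, and $x\le y$ implies $y=x\vee(x^\perp\wedge y)$. Write $x\perp y$ iff $x\le y^\perp$. A linear map $f\colon X\to Y$ is a function for which there exists $h\colon Y\to X$ (its adjoint, unique, denoted $f^*$) with $f(x)\perp y\iff x\perp h(y)$ for all $x\in X,y\in Y$. -}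

module Defs where

open import Level using (Level; _⊔_) renaming (suc to lsuc)
open import Algebra.Core using (Op₁; Op₂)
open import Data.Product using (Σ; _×_; _,_; proj₁; proj₂)
open import Function.Bundles using (_⇔_)
open import Relation.Binary.Core using (Rel)
open import Relation.Binary.Lattice.Structures using (IsBoundedLattice)

record IsOrthomodularLattice {a ℓ₁ ℓ₂ : Level} {A : Set a}
         (_≈_ : Rel A ℓ₁) (_≤_ : Rel A ℓ₂)
         (_∨_ _∧_ : Op₂ A) (1# 0# : A) (_ᶜ : Op₁ A)
         : Set (a ⊔ ℓ₁ ⊔ ℓ₂) where
  field
    isBoundedLattice : IsBoundedLattice _≈_ _≤_ _∨_ _∧_ 1# 0#
    involutive       : ∀ x → ((x ᶜ) ᶜ) ≈ x
    antitone         : ∀ {x y} → x ≤ y → (y ᶜ) ≤ (x ᶜ)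
    meet-complement  : ∀ x → (x ∧ (x ᶜ)) ≈ 0#
    orthomodular     : ∀ {x y} → x ≤ y → y ≈ (x ∨ ((x ᶜ) ∧ y))

record OrthomodularLattice (a ℓ₁ ℓ₂ : Level) : Set (lsuc (a ⊔ ℓ₁ ⊔ ℓ₂)) where
  infixr 7 _∧_
  infixr 6 _∨_
  infix  4 _≈_ _≤_
  field
    Carrier : Set a
    _≈_     : Rel Carrier ℓ₁
    _≤_     : Rel Carrier ℓ₂
    _∨_     : Op₂ Carrier
    _∧_     : Op₂ Carrier
    1#      : Carrier
    0#      : Carrier
    _ᶜ      : Op₁ Carrier
    isOrthomodularLattice : IsOrthomodularLattice _≈_ _≤_ _∨_ _∧_ 1# 0# _ᶜ

  open IsOrthomodularLattice isOrthomodularLattice public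

  infix 4 _⊥_
  _⊥_ : Rel Carrier ℓ₂
  x ⊥ y = x ≤ (y ᶜ)

module _ {a₁ ℓ₁ ℓ₂ a₂ ℓ₃ ℓ₄ : Level}
         (X : OrthomodularLattice a₁ ℓ₁ ℓ₂) (Y : OrthomodularLattice a₂ ℓ₃ ℓ₄) where
  private
    module X = OrthomodularLattice X
    module Y = OrthomodularLattice Y

  IsAdjoint : (X.Carrier → Y.Carrier) → (Y.Carrier → X.Carrier) → Set (a₁ ⊔ a₂ ⊔ ℓ₂ ⊔ ℓ₄)
  IsAdjoint f h = ∀ x y → (f x Y.⊥ y) ⇔ (x X.⊥ h y)

  IsLinear : (X.Carrier → Y.Carrier) → Set (a₁ ⊔ a₂ ⊔ ℓ₂ ⊔ ℓ₄)
  IsLinear f = Σ (Y.Carrier → X.Carrier) (IsAdjoint f)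

  Ker : (X.Carrier → Y.Carrier) → Set (a₁ ⊔ ℓ₃)
  Ker f = Σ X.Carrier (λ x → f x Y.≈ Y.0#)

{-# OPTIONS --safe #-}
module Submission where

open import Defs
open import Level using (Level)
open import Algebra.Core using (Op₁; Op₂)
open import Data.Product using (Σ; _×_; _,_; proj₁; proj₂)
open import Function.Bundles using (_⇔_; mk⇔; Equivalence)
import Function.Properties.Equivalence as ⇔
open import Relation.Binary.Lattice.Bundles using (Lattice)
open import Relation.Binary.Lattice.Structures using (IsBoundedLattice)
import Relation.Binary.Lattice.Properties.JoinSemilattice as JoinSemilatticeProperties
import Relation.Binary.Lattice.Properties.MeetSemilattice as MeetSemilatticeProperties
import Relation.Binary.Reasoning.PartialOrder as PosetReasoning
import Relation.Binary.Construct.On as On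

-- The kernel of f consists of the x with f x ⊥ 1, i.e. (by adjointness) x ⊥ f* 1.
-- On a principal down-set ↓c of an orthomodular lattice the relative complement
-- x ↦ c ∧ xᶜ is again an orthocomplement satisfying the orthomodular law, since
-- for x ≤ c orthomodularity gives c ∧ (c ∧ xᶜ)ᶜ = x.

module OrthomodularLatticeProperties {a ℓ₁ ℓ₂ : Level} (L : OrthomodularLattice a ℓ₁ ℓ₂) where
  open OrthomodularLattice L
  open IsBoundedLattice isBoundedLattice public

  lattice : Lattice a ℓ₁ ℓ₂
  lattice = record { isLattice = isLattice }

  open Lattice lattice using (poset; joinSemilattice; meetSemilattice)
  open JoinSemilatticeProperties joinSemilattice using (∨-monotonic)
  open MeetSemilatticeProperties meetSemilattice using (∧-monotonic)
  open PosetReasoning poset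

  ⊥-sym : ∀ {x y} → x ⊥ y → y ⊥ x
  ⊥-sym {x} {y} x≤yᶜ = begin
    y         ≈⟨ Eq.sym (involutive y) ⟩
    y ᶜ ᶜ     ≤⟨ antitone x≤yᶜ ⟩
    x ᶜ       ∎

  ᶜ-reflects-≤ : ∀ {x y} → x ᶜ ≤ y ᶜ → y ≤ x
  ᶜ-reflects-≤ {x} {y} xᶜ≤yᶜ = begin
    y     ≤⟨ ⊥-sym xᶜ≤yᶜ ⟩
    x ᶜ ᶜ ≈⟨ involutive x ⟩
    x     ∎

  ≈0#⇔⊥1# : ∀ x → (x ≈ 0#) ⇔ (x ⊥ 1#)
  ≈0#⇔⊥1# x = mk⇔ (λ x≈0 → trans (reflexive x≈0) (minimum _)) ⊥1⇒≈0
    where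
    ⊥1⇒≈0 : x ⊥ 1# → x ≈ 0#
    ⊥1⇒≈0 x≤1ᶜ = antisym (begin
      x           ≤⟨ ∧-greatest (maximum x) x≤1ᶜ ⟩
      1# ∧ 1# ᶜ   ≈⟨ meet-complement 1# ⟩
      0#          ∎) (minimum x)

  relative-ᶜ-antitone : ∀ c {x y} → x ≤ y → c ∧ y ᶜ ≤ c ∧ x ᶜ
  relative-ᶜ-antitone c x≤y = ∧-monotonic refl (antitone x≤y)

  relative-meet-complement : ∀ c x → x ∧ (c ∧ x ᶜ) ≈ 0#
  relative-meet-complement c x = antisym (begin
    x ∧ (c ∧ x ᶜ) ≤⟨ ∧-monotonic refl (x∧y≤y c (x ᶜ)) ⟩
    x ∧ x ᶜ       ≈⟨ meet-complement x ⟩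
    0#            ∎) (minimum _)

  relative-ᶜ-involutive : ∀ {c x} → x ≤ c → c ∧ (c ∧ x ᶜ) ᶜ ≈ x
  relative-ᶜ-involutive {c} {x} x≤c =
    antisym (ᶜ-reflects-≤ xᶜ≤) (∧-greatest x≤c (⊥-sym (x∧y≤y c (x ᶜ))))
    where
    xᶜ≤ : x ᶜ ≤ (c ∧ (c ∧ x ᶜ) ᶜ) ᶜ
    xᶜ≤ = begin
      x ᶜ                  ≈⟨ orthomodular (antitone x≤c) ⟩
      c ᶜ ∨ (c ᶜ ᶜ ∧ x ᶜ)  ≤⟨ ∨-monotonic refl (∧-monotonic (reflexive (involutive c)) refl) ⟩
      c ᶜ ∨ (c ∧ x ᶜ)      ≤⟨ ∨-least (antitone (x∧y≤x _ _)) (⊥-sym (x∧y≤y _ _)) ⟩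
      (c ∧ (c ∧ x ᶜ) ᶜ) ᶜ  ∎

  relative-orthomodular : ∀ {c x y} → x ≤ y → y ≤ c → y ≈ x ∨ ((c ∧ x ᶜ) ∧ y)
  relative-orthomodular {c} {x} {y} x≤y y≤c = antisym (begin
    y                     ≈⟨ orthomodular x≤y ⟩
    x ∨ (x ᶜ ∧ y)         ≤⟨ ∨-monotonic refl xᶜ∧y≤[c∧xᶜ]∧y ⟩
    x ∨ ((c ∧ x ᶜ) ∧ y)   ∎) (∨-least x≤y (x∧y≤y _ _))
    where
    xᶜ∧y≤[c∧xᶜ]∧y : x ᶜ ∧ y ≤ (c ∧ x ᶜ) ∧ y
    xᶜ∧y≤[c∧xᶜ]∧y = ∧-greatest (∧-greatest (trans (x∧y≤y _ _) y≤c) (x∧y≤x _ _)) (x∧y≤y _ _)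

module _ {a₁ ℓ₁ ℓ₂ a₂ ℓ₃ ℓ₄ : Level}
    (X : OrthomodularLattice a₁ ℓ₁ ℓ₂) (Y : OrthomodularLattice a₂ ℓ₃ ℓ₄) where
  private
    module X = OrthomodularLattice X
    module Y = OrthomodularLattice Y

  f≈0⇔⊥f*1 : ∀ {f f*} → IsAdjoint X Y f f* → ∀ x → (f x Y.≈ Y.0#) ⇔ (x X.≤ f* Y.1# X.ᶜ)
  f≈0⇔⊥f*1 {f} adj x = ⇔.trans (OrthomodularLatticeProperties.≈0#⇔⊥1# Y (f x)) (adj x Y.1#)

-- Parametrised by any P with P x ⇔ x ≤ c, so that it applies verbatim to the
-- kernel, whose membership predicate is f x ≈ 0 rather than x ≤ f* 1 ᶜ.
module PrincipalDownset {a ℓ₁ ℓ₂ p : Level} (L : OrthomodularLattice a ℓ₁ ℓ₂)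
    (c : OrthomodularLattice.Carrier L) (P : OrthomodularLattice.Carrier L → Set p)
    (P⇔≤c : ∀ x → P x ⇔ OrthomodularLattice._≤_ L x c) where
  open OrthomodularLattice L
  open OrthomodularLatticeProperties L

  D : Set _
  D = Σ Carrier P

  ≤c : (u : D) → proj₁ u ≤ c
  ≤c (x , Px) = Equivalence.to (P⇔≤c x) Px

  ↓ : (x : Carrier) → x ≤ c → D
  ↓ x x≤c = x , Equivalence.from (P⇔≤c x) x≤c

  _∨↓_ : Op₂ D
  u ∨↓ v = ↓ (proj₁ u ∨ proj₁ v) (∨-least (≤c u) (≤c v))

  _∧↓_ : Op₂ D
  u ∧↓ v = ↓ (proj₁ u ∧ proj₁ v) (trans (x∧y≤x _ _) (≤c u))

  ⊤↓ : D
  ⊤↓ = ↓ c refl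

  ⊥↓ : D
  ⊥↓ = ↓ 0# (minimum c)

  _ᶜ↓ : Op₁ D
  u ᶜ↓ = ↓ (c ∧ proj₁ u ᶜ) (x∧y≤x _ _)

  isOrthomodularLattice↓ : IsOrthomodularLattice (λ u v → proj₁ u ≈ proj₁ v) (λ u v → proj₁ u ≤ proj₁ v)
                             _∨↓_ _∧↓_ ⊤↓ ⊥↓ _ᶜ↓
  isOrthomodularLattice↓ = record
    { isBoundedLattice = record
      { isLattice = record
        { isPartialOrder = On.isPartialOrder proj₁ isPartialOrder
        ; supremum = λ u v → x≤x∨y _ _ , y≤x∨y _ _ , λ w → ∨-least
        ; infimum = λ u v → x∧y≤x _ _ , x∧y≤y _ _ , λ w → ∧-greatest
        }
      ; maximum = ≤c
      ; minimum = λ u → minimum (proj₁ u)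
      }
    ; involutive = λ u → relative-ᶜ-involutive (≤c u)
    ; antitone = relative-ᶜ-antitone c
    ; meet-complement = λ u → relative-meet-complement c (proj₁ u)
    ; orthomodular = λ {u} {v} u≤v → relative-orthomodular u≤v (≤c v)
    }

mainTheorem5 : {a₁ ℓ₁ ℓ₂ a₂ ℓ₃ ℓ₄ : Level}
    (X : OrthomodularLattice a₁ ℓ₁ ℓ₂) (Y : OrthomodularLattice a₂ ℓ₃ ℓ₄)
    (f : OrthomodularLattice.Carrier X → OrthomodularLattice.Carrier Y)
    (f* : OrthomodularLattice.Carrier Y → OrthomodularLattice.Carrier X) →
    IsAdjoint X Y f f* →
    let open OrthomodularLattice X
        module Y = OrthomodularLattice Y
        a = (f* Y.1#) ᶜ
        K = Ker X Y f
    in (∀ x → (f x Y.≈ Y.0#) ⇔ (x ≤ a))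
       × Σ (Op₂ K) λ _∨K_ → Σ (Op₂ K) λ _∧K_ → Σ K λ 1K → Σ K λ 0K → Σ (Op₁ K) λ _ᶜK →
           ((∀ u v → proj₁ (u ∨K v) ≈ (proj₁ u ∨ proj₁ v))
          × (∀ u v → proj₁ (u ∧K v) ≈ (proj₁ u ∧ proj₁ v))
          × (∀ u → proj₁ (u ᶜK) ≈ (a ∧ (proj₁ u ᶜ)))
          × (proj₁ 1K ≈ a)
          × (proj₁ 0K ≈ 0#)
          × IsOrthomodularLattice (λ u v → proj₁ u ≈ proj₁ v) (λ u v → proj₁ u ≤ proj₁ v)
              _∨K_ _∧K_ 1K 0K _ᶜK)
mainTheorem5 X Y f f* adj =
  f≈0⇔⊥f*1 X Y adj , _∨↓_ , _∧↓_ , ⊤↓ , ⊥↓ , _ᶜ↓ ,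
  (λ _ _ → Eq.refl) , (λ _ _ → Eq.refl) , (λ _ → Eq.refl) , Eq.refl , Eq.refl ,
  isOrthomodularLattice↓
  where
  module X = OrthomodularLattice X
  module Y = OrthomodularLattice Y
  open PrincipalDownset X (f* Y.1# X.ᶜ) (λ x → f x Y.≈ Y.0#) (f≈0⇔⊥f*1 X Y adj)
  open OrthomodularLatticeProperties X using (module Eq)
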